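{- If $G$ is a regular closed distance magic graph, then $-1\in Sp(G)$.
   Context: A graph $G$ on $n$ vertices is closed distance magic if there is a bijection $\ell\colon V(G)\to\{1,\dots,n\}$ and a positive integer $k'$ such that $\sum_{y\in N[x]}\ell(y)=k'$ for every vertex $x$, where $N[x]$ is the closed neighborhood of $x$. $Sp(G)$ denotes the spectrum (set of eigenvalues) of the adjacency matrix of $G$. -}

module Defs where

open import Data.Nat as ℕ using (ℕ; zero; suc; _≤_)
open import Data.Fin using (Fin; zero; suc; toℕ; _≟_)
open import Data.Bool using (Bool; true; false; if_then_else_; _∨_)
open import Data.Product using (Σ; ∃; _×_; _,_)
open import Data.Rational as ℚ using (ℚ; 0ℚ; 1ℚ)
open import Relation.Binary.PropositionalEquality using (_≡_; _≢_)
open import Relation.Nullary.Decidable using (⌊_⌋)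
open import Function.Definitions using (Bijective)

record SimpleGraph (n : ℕ) : Set where
  field
    Adj    : Fin n → Fin n → Bool
    sym    : ∀ x y → Adj x y ≡ Adj y x
    irrefl : ∀ x → Adj x x ≡ false
open SimpleGraph public

sumℕ : ∀ {n} → (Fin n → ℕ) → ℕ
sumℕ {zero}  f = 0
sumℕ {suc n} f = f zero ℕ.+ sumℕ (λ i → f (suc i))

sumℚ : ∀ {n} → (Fin n → ℚ) → ℚ
sumℚ {zero}  f = 0ℚ
sumℚ {suc n} f = f zero ℚ.+ sumℚ (λ i → f (suc i))

degree : ∀ {n} → SimpleGraph n → Fin n → ℕ
degree G x = sumℕ (λ y → if Adj G x y then 1 else 0)

Regular : ∀ {n} → SimpleGraph n → Set
Regular {n} G = Σ ℕ λ r → ∀ (x : Fin n) → degree G x ≡ r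

inClosedNbhd : ∀ {n} → SimpleGraph n → Fin n → Fin n → Bool
inClosedNbhd G x y = ⌊ x ≟ y ⌋ ∨ Adj G x y

-- Labelling ℓ : V → {1,…,n}, encoded as a bijection Fin n → Fin n with
-- label value toℕ (ℓ x) + 1.
closedNbhdSum : ∀ {n} → SimpleGraph n → (Fin n → Fin n) → Fin n → ℕ
closedNbhdSum G ℓ x = sumℕ (λ y → if inClosedNbhd G x y then suc (toℕ (ℓ y)) else 0)

ClosedDistanceMagic : ∀ {n} → SimpleGraph n → Set
ClosedDistanceMagic {n} G =
  Σ (Fin n → Fin n) λ ℓ → Bijective _≡_ _≡_ ℓ ×
    Σ ℕ λ k′ → (1 ≤ k′) × (∀ (x : Fin n) → closedNbhdSum G ℓ x ≡ k′)

adjMatrix : ∀ {n} → SimpleGraph n → Fin n → Fin n → ℚ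
adjMatrix G i j = if Adj G i j then 1ℚ else 0ℚ

_∈Sp_ : ∀ {n} → ℚ → SimpleGraph n → Set
_∈Sp_ {n} λ₀ G =
  Σ (Fin n → ℚ) λ v → (Σ (Fin n) λ i → v i ≢ 0ℚ) ×
    (∀ (i : Fin n) → sumℚ (λ j → adjMatrix G i j ℚ.* v j) ≡ λ₀ ℚ.* v i)

-- If ℓ is closed distance magic with constant k and G is r-regular with adjacency matrix A, then
-- Aℓ = k𝟙 − ℓ and A𝟙 = r𝟙, so v = (r + 1)ℓ − k𝟙 satisfies Av = (r + 1)(k𝟙 − ℓ) − rk𝟙 = −v.
-- As ℓ is injective and n ≥ 2, v is not constant, hence not zero.
module Submission where

open import Defs
open import Data.Nat using (ℕ; _≤_)
open import Data.Rational using (ℚ; 1ℚ; -_)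

open import Data.Bool using (Bool; true; false; if_then_else_)
open import Data.Fin using (Fin; zero; suc; toℕ; _≟_)
open import Data.Fin.Properties using (toℕ-injective)
open import Data.Nat as ℕ using (zero; suc; s≤s; z≤n)
import Data.Nat.Properties as ℕ
open import Data.Product using (Σ; _,_)
open import Data.Rational as ℚ using (0ℚ; _+_; _*_; _-_; Positive; NonNegative)
import Data.Rational.Properties as ℚ
open import Data.Rational.Solver using (module +-*-Solver)
open import Function.Base using (_∘_)
open import Function.Definitions using (Injective)
open import Relation.Binary.PropositionalEquality as ≡ hiding (sym)
open import Relation.Nullary using (yes; no; contradiction)
open import Relation.Nullary.Decidable using (⌊_⌋; ⌊⌋-map′)

open import Algebra.Properties.CommutativeSemigroup ℕ.+-commutativeSemigroup using (interchange)
open import Algebra.Properties.Group ℚ.+-0-group using (∙-cancelˡ; ∙-cancelʳ)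
open import Algebra.Properties.Monoid.Mult ℚ.+-0-monoid using (_×_; ×-homo-+)
open +-*-Solver

fromℕ : ℕ → ℚ
fromℕ n = n × 1ℚ

fromℕ-nonNeg : ∀ n → NonNegative (fromℕ n)
fromℕ-nonNeg zero    = _
fromℕ-nonNeg (suc n) = ℚ.nonNeg+nonNeg⇒nonNeg 1ℚ (fromℕ n) {{fromℕ-nonNeg n}}

fromℕ-suc-pos : ∀ n → Positive (fromℕ (suc n))
fromℕ-suc-pos n = ℚ.pos+nonNeg⇒pos 1ℚ (fromℕ n) {{fromℕ-nonNeg n}}

0≢fromℕ-suc : ∀ n → 0ℚ ≢ fromℕ (suc n)
0≢fromℕ-suc n = ℚ.<⇒≢ (ℚ.positive⁻¹ _ {{fromℕ-suc-pos n}})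

fromℕ-injective : Injective _≡_ _≡_ fromℕ
fromℕ-injective {zero}  {zero}  _  = refl
fromℕ-injective {zero}  {suc n} eq = contradiction eq (0≢fromℕ-suc n)
fromℕ-injective {suc m} {zero}  eq = contradiction (≡.sym eq) (0≢fromℕ-suc m)
fromℕ-injective {suc m} {suc n} eq = cong suc (fromℕ-injective (∙-cancelˡ 1ℚ _ _ eq))

fromℕ-if : ∀ (b : Bool) m → fromℕ (if b then m else 0) ≡ (if b then 1ℚ else 0ℚ) * fromℕ m
fromℕ-if true  m = ≡.sym (ℚ.*-identityˡ (fromℕ m))
fromℕ-if false m = ≡.sym (ℚ.*-zeroˡ (fromℕ m))

fromℕ-sum : ∀ {n} (f : Fin n → ℕ) → fromℕ (sumℕ f) ≡ sumℚ (λ j → fromℕ (f j))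
fromℕ-sum {zero}  f = refl
fromℕ-sum {suc n} f =
  trans (×-homo-+ 1ℚ (f zero) _) (cong (fromℕ (f zero) +_) (fromℕ-sum (λ j → f (suc j))))

sumℕ-cong : ∀ {n} {f g : Fin n → ℕ} → (∀ j → f j ≡ g j) → sumℕ f ≡ sumℕ g
sumℕ-cong {zero}  _   = refl
sumℕ-cong {suc n} f≗g = cong₂ ℕ._+_ (f≗g zero) (sumℕ-cong (λ j → f≗g (suc j)))

sumℚ-cong : ∀ {n} {f g : Fin n → ℚ} → (∀ j → f j ≡ g j) → sumℚ f ≡ sumℚ g
sumℚ-cong {zero}  _   = refl
sumℚ-cong {suc n} f≗g = cong₂ _+_ (f≗g zero) (sumℚ-cong (λ j → f≗g (suc j)))

sumℕ-zero : ∀ n → sumℕ {n} (λ _ → 0) ≡ 0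
sumℕ-zero zero    = refl
sumℕ-zero (suc n) = sumℕ-zero n

sumℕ-distrib-+ : ∀ {n} (f g : Fin n → ℕ) → sumℕ (λ j → f j ℕ.+ g j) ≡ sumℕ f ℕ.+ sumℕ g
sumℕ-distrib-+ {zero}  f g = refl
sumℕ-distrib-+ {suc n} f g =
  trans (cong (f zero ℕ.+ g zero ℕ.+_) (sumℕ-distrib-+ (λ j → f (suc j)) (λ j → g (suc j))))
        (interchange (f zero) (g zero) _ _)

sumℕ-select : ∀ {n} (i : Fin n) (h : Fin n → ℕ) → sumℕ (λ j → if ⌊ i ≟ j ⌋ then h j else 0) ≡ h i
sumℕ-select {suc n} zero    h = trans (cong (h zero ℕ.+_) (sumℕ-zero n)) (ℕ.+-identityʳ (h zero))
sumℕ-select {suc n} (suc i) h = trans (sumℕ-cong (λ j → cong (λ b → if b then h (suc j) else 0)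
                                                            (⌊⌋-map′ _ _ (i ≟ j))))
                                      (sumℕ-select i (λ j → h (suc j)))

sumℚ-linear : ∀ {n} (a b : ℚ) (f g : Fin n → ℚ) →
              sumℚ (λ j → a * f j - b * g j) ≡ a * sumℚ f - b * sumℚ g
sumℚ-linear {zero}  a b f g = solve 2 (λ a b → con 0ℚ := a :* con 0ℚ :- b :* con 0ℚ) refl a b
sumℚ-linear {suc n} a b f g =
  trans (cong ((a * f zero - b * g zero) +_) (sumℚ-linear a b (λ j → f (suc j)) (λ j → g (suc j))))
        (solve 6 (λ a b x y s t → (a :* x :- b :* y) :+ (a :* s :- b :* t) := a :* (x :+ s) :- b :* (y :+ t))
               refl a b (f zero) (g zero) (sumℚ (λ j → f (suc j))) (sumℚ (λ j → g (suc j))))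

*-cancelˡ-≡-pos : ∀ r {p q} .{{_ : Positive r}} → r * p ≡ r * q → p ≡ q
*-cancelˡ-≡-pos r eq = ℚ.≤-antisym (ℚ.*-cancelˡ-≤-pos r (ℚ.≤-reflexive eq))
                                   (ℚ.*-cancelˡ-≤-pos r (ℚ.≤-reflexive (≡.sym eq)))

affine-injective : ∀ c k .{{_ : Positive c}} → Injective _≡_ _≡_ (λ x → c * x - k)
affine-injective c k eq = *-cancelˡ-≡-pos c (∙-cancelʳ (- k) _ _ eq)

nonzero-entry : ∀ {n} (v : Fin n → ℚ) {i j} → v i ≢ v j → Σ (Fin n) λ l → v l ≢ 0ℚ
nonzero-entry v {i} {j} vi≢vj with v i ℚ.≟ 0ℚ
... | no  vi≢0 = i , vi≢0
... | yes vi≡0 = j , λ vj≡0 → vi≢vj (trans vi≡0 (≡.sym vj≡0))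

regular∧closedSum-const⇒eigen-−1 :
  ∀ {n} (A : Fin n → Fin n → ℚ) (u : Fin n → ℚ) (r k : ℚ) →
  (∀ i → sumℚ (A i) ≡ r) → (∀ i → u i + sumℚ (λ j → A i j * u j) ≡ k) →
  ∀ i → sumℚ (λ j → A i j * ((1ℚ + r) * u j - k)) ≡ - 1ℚ * ((1ℚ + r) * u i - k)
regular∧closedSum-const⇒eigen-−1 A u r k rowSum closedSum i = begin
  sumℚ (λ j → A i j * (c * u j - k))           ≡⟨ sumℚ-cong (λ j → distribute (A i j) (u j)) ⟩
  sumℚ (λ j → c * (A i j * u j) - k * A i j)   ≡⟨ sumℚ-linear c k _ (A i) ⟩
  c * S - k * sumℚ (A i)                       ≡⟨ cong (λ d → c * S - k * d) (rowSum i) ⟩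
  c * S - k * r                                ≡⟨ cong (λ k′ → c * S - k′ * r) (≡.sym (closedSum i)) ⟩
  c * S - (u i + S) * r                        ≡⟨ solve 3 (λ r x s → (con 1ℚ :+ r) :* s :- (x :+ s) :* r
                                                   := (:- con 1ℚ) :* ((con 1ℚ :+ r) :* x :- (x :+ s)))
                                                   refl r (u i) S ⟩
  - 1ℚ * (c * u i - (u i + S))                 ≡⟨ cong (λ k′ → - 1ℚ * (c * u i - k′)) (closedSum i) ⟩
  - 1ℚ * (c * u i - k)                         ∎
  where
  open ≡-Reasoning
  c S : ℚ
  c = 1ℚ + r
  S = sumℚ (λ j → A i j * u j)
  distribute : ∀ a x → a * (c * x - k) ≡ c * (a * x) - k * a
  distribute a x = solve 4 (λ a x c k → a :* (c :* x :- k) := c :* (a :* x) :- k :* a) refl a x c k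

label : ∀ {n} → (Fin n → Fin n) → Fin n → ℕ
label ℓ y = suc (toℕ (ℓ y))

module _ {n} (G : SimpleGraph n) where

  nbhdSum : (Fin n → ℕ) → Fin n → ℕ
  nbhdSum m x = sumℕ (λ y → if Adj G x y then m y else 0)

  closedNbhd-indicator-split : ∀ (m : Fin n → ℕ) x y →
    (if inClosedNbhd G x y then m y else 0) ≡ (if ⌊ x ≟ y ⌋ then m y else 0) ℕ.+ (if Adj G x y then m y else 0)
  closedNbhd-indicator-split m x y with x ≟ y
  ... | yes refl rewrite irrefl G x = ≡.sym (ℕ.+-identityʳ (m x))
  ... | no  _    = refl

  closedNbhdSum-split : ∀ ℓ x → closedNbhdSum G ℓ x ≡ label ℓ x ℕ.+ nbhdSum (label ℓ) x
  closedNbhdSum-split ℓ x = begin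
    closedNbhdSum G ℓ x
      ≡⟨ sumℕ-cong (closedNbhd-indicator-split (label ℓ) x) ⟩
    sumℕ (λ y → (if ⌊ x ≟ y ⌋ then label ℓ y else 0) ℕ.+ (if Adj G x y then label ℓ y else 0))
      ≡⟨ sumℕ-distrib-+ (λ y → if ⌊ x ≟ y ⌋ then label ℓ y else 0) _ ⟩
    sumℕ (λ y → if ⌊ x ≟ y ⌋ then label ℓ y else 0) ℕ.+ nbhdSum (label ℓ) x
      ≡⟨ cong (ℕ._+ nbhdSum (label ℓ) x) (sumℕ-select x (label ℓ)) ⟩
    label ℓ x ℕ.+ nbhdSum (label ℓ) x ∎
    where open ≡-Reasoning

  fromℕ-nbhdSum : ∀ m x → fromℕ (nbhdSum m x) ≡ sumℚ (λ y → adjMatrix G x y * fromℕ (m y))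
  fromℕ-nbhdSum m x = trans (fromℕ-sum (λ y → if Adj G x y then m y else 0))
                            (sumℚ-cong (λ y → fromℕ-if (Adj G x y) (m y)))

  fromℕ-degree : ∀ x → fromℕ (degree G x) ≡ sumℚ (adjMatrix G x)
  fromℕ-degree x = trans (fromℕ-nbhdSum (λ _ → 1) x)
    (sumℚ-cong (λ y → trans (cong (adjMatrix G x y *_) (ℚ.+-identityʳ 1ℚ)) (ℚ.*-identityʳ _)))

  fromℕ-closedNbhdSum : ∀ ℓ x → fromℕ (closedNbhdSum G ℓ x) ≡
    fromℕ (label ℓ x) + sumℚ (λ y → adjMatrix G x y * fromℕ (label ℓ y))
  fromℕ-closedNbhdSum ℓ x = begin
    fromℕ (closedNbhdSum G ℓ x)                        ≡⟨ cong fromℕ (closedNbhdSum-split ℓ x) ⟩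
    fromℕ (label ℓ x ℕ.+ nbhdSum (label ℓ) x)          ≡⟨ ×-homo-+ 1ℚ (label ℓ x) (nbhdSum (label ℓ) x) ⟩
    fromℕ (label ℓ x) + fromℕ (nbhdSum (label ℓ) x)    ≡⟨ cong (fromℕ (label ℓ x) +_) (fromℕ-nbhdSum (label ℓ) x) ⟩
    fromℕ (label ℓ x) + sumℚ (λ y → adjMatrix G x y * fromℕ (label ℓ y)) ∎
    where open ≡-Reasoning

mainTheorem4 : ∀ {n : ℕ} → 2 ≤ n → (G : SimpleGraph n) → Regular G →
    ClosedDistanceMagic G → (- 1ℚ) ∈Sp G
mainTheorem4 {suc (suc _)} (s≤s (s≤s z≤n)) G (r , regular) (ℓ , (ℓ-injective , _) , k , _ , magic) =
  v , nonzero-entry v (λ v0≡v1 → 0≢1 (v-injective v0≡v1)) , eigen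
  where
  u v : Fin _ → ℚ
  u y = fromℕ (label ℓ y)
  v y = fromℕ (suc r) * u y - fromℕ k

  v-injective : Injective _≡_ _≡_ v
  v-injective = ℓ-injective ∘ toℕ-injective ∘ ℕ.suc-injective ∘ fromℕ-injective
              ∘ affine-injective (fromℕ (suc r)) (fromℕ k) {{fromℕ-suc-pos r}}

  0≢1 : zero ≢ suc zero
  0≢1 ()

  eigen : ∀ x → sumℚ (λ y → adjMatrix G x y * v y) ≡ - 1ℚ * v x
  eigen = regular∧closedSum-const⇒eigen-−1 (adjMatrix G) u (fromℕ r) (fromℕ k)
    (λ x → trans (≡.sym (fromℕ-degree G x)) (cong fromℕ (regular x)))
    (λ x → trans (≡.sym (fromℕ-closedNbhdSum G ℓ x)) (cong fromℕ (magic x)))
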